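{- Let $2 \le m \le n$ and let $G$ and $H$ be connected graphs of orders $m$ and $n$, respectively. For every integer $k \ge 1$, $$d_k(G \boxtimes H) \ge \min\{\, n + 2\delta(G) - 1,\ m + 2\delta(H) - 1 \,\}.$$
   Context: $\delta(\cdot)$ is the minimum degree. $G \boxtimes H$ is the strong product: vertex set $V(G)\times V(H)$, with distinct $(x,y)$ and $(u,v)$ adjacent iff ($x=u$ or $xu\in E(G)$) and ($y=v$ or $yv\in E(H)$). The $k$-move deduction game ($k$ a positive integer) on a finite graph $G$: a layout places a finite number of searchers on vertices of $G$ (several searchers may share a vertex). Every searcher is initially mobile. A vertex is protected once it has been occupied by some searcher (so initially occupied vertices are protected); other vertices are unprotected. The game proceeds in stages. At each stage, for every vertex $v$ that has at least one unprotected neighbour: if the number of mobile searchers on $v$ is at least the number of unprotected neighbours of $v$, then the mobile searchers on $v$ move to the unprotected neighbours of $v$ so that each unprotected neighbour receives at least one searcher; excess mobile searchers on $v$ may also move to any of these unprotected neighbours. All moves in a stage happen simultaneously, newly occupied vertices become protected, and a searcher that has moved $k$ times becomes immobile. The process repeats until all vertices are protected or no searcher can move. A layout is successful if all vertices of $G$ end up protected. The $k$-move deduction number $d_k(G)$ is the minimum number of searchers in a successful layout on $G$. -}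

module Defs where

open import Data.Nat using (ℕ; zero; suc; _+_; _*_; _⊓_; _<_; _≤_; _∸_)
import Data.Nat
open import Data.Bool using (Bool; true; false; _∧_; _∨_; not; if_then_else_)
open import Data.Fin using (Fin; zero; suc; remQuot; _≟_)
open import Data.Product using (Σ; _×_; _,_; ∃; proj₁; proj₂)
open import Data.Sum using (_⊎_)
open import Data.Maybe using (Maybe; just; nothing)
open import Relation.Nullary using (¬_; does)
open import Relation.Binary.PropositionalEquality using (_≡_)
open import Relation.Binary.Construct.Closure.ReflexiveTransitive using (Star)

record Graph (n : ℕ) : Set where
  field
    adj    : Fin n → Fin n → Bool
    sym    : ∀ u v → adj u v ≡ adj v u
    irrefl : ∀ v → adj v v ≡ false
open Graph public

Adj : ∀ {n} → Graph n → Fin n → Fin n → Set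
Adj G u v = adj G u v ≡ true

Connected : ∀ {n} → Graph n → Set
Connected {n} G = ∀ (u v : Fin n) → Star (Adj G) u v

countF : ∀ {n} → (Fin n → Bool) → ℕ
countF {zero}  f = 0
countF {suc n} f = (if f zero then 1 else 0) + countF (λ i → f (suc i))

minF : ∀ {n} → (Fin (suc n) → ℕ) → ℕ
minF {zero}  f = f zero
minF {suc n} f = f zero ⊓ minF (λ i → f (suc i))

deg : ∀ {n} → Graph n → Fin n → ℕ
deg G v = countF (adj G v)

-- minimum degree (convention 0 for the empty graph; never used here)
δ : ∀ {n} → Graph n → ℕ
δ {zero}  G = 0
δ {suc n} G = minF (deg G)

-- Strong product; vertex (x , y) ∈ Fin m × Fin n is encoded as an element
-- of Fin (m * n) via the standard bijection remQuot / combine.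

eqB : ∀ {n} → Fin n → Fin n → Bool
eqB x y = does (x ≟ y)

closedAdj : ∀ {n} → Graph n → Fin n → Fin n → Bool
closedAdj G x u = eqB x u ∨ adj G x u

strongAdj : ∀ {m n} → Graph m → Graph n → Fin (m * n) → Fin (m * n) → Bool
strongAdj {m} {n} G H p q with remQuot {m} n p | remQuot {m} n q
... | (x , y) | (u , v) =
  not (eqB x u ∧ eqB y v) ∧ (closedAdj G x u ∧ closedAdj H y v)

record GState (N s : ℕ) : Set where
  field
    pos   : Fin s → Fin N
    moves : Fin s → ℕ
    prot  : Fin N → Bool       -- protected vertices (ever occupied)
open GState public

module Game {N : ℕ} (A : Fin N → Fin N → Bool) (k : ℕ) {s : ℕ} where

  Mobile : GState N s → Fin s → Set
  Mobile st i = moves st i < k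

  mobileB : GState N s → Fin s → Bool
  mobileB st i = does (suc (moves st i) Data.Nat.≤? k)

  unprotNbrs : GState N s → Fin N → ℕ
  unprotNbrs st v = countF (λ w → A v w ∧ not (prot st w))

  mobileOn : GState N s → Fin N → ℕ
  mobileOn st v = countF (λ i → eqB (pos st i) v ∧ mobileB st i)

  Fires : GState N s → Fin N → Set
  Fires st v = (0 < unprotNbrs st v) × (unprotNbrs st v ≤ mobileOn st v)

  ValidChoice : GState N s → (Fin s → Maybe (Fin N)) → Set
  ValidChoice st c =
    (∀ i w → c i ≡ just w →
       Mobile st i × Fires st (pos st i) × A (pos st i) w ≡ true × prot st w ≡ false)
    × (∀ v → Fires st v → ∀ w → A v w ≡ true → prot st w ≡ false →
         ∃ λ i → pos st i ≡ v × c i ≡ just w)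

  newPos : GState N s → (Fin s → Maybe (Fin N)) → Fin s → Fin N
  newPos st c i with c i
  ... | just w  = w
  ... | nothing = pos st i

  newMoves : GState N s → (Fin s → Maybe (Fin N)) → Fin s → ℕ
  newMoves st c i with c i
  ... | just w  = suc (moves st i)
  ... | nothing = moves st i

  occupied : (Fin s → Fin N) → Fin N → Bool
  occupied p w = does (0 Data.Nat.<? countF (λ i → eqB (p i) w))

  -- one stage of the game (all moves simultaneous)
  Stage : GState N s → GState N s → Set
  Stage st st' = ∃ λ c → ValidChoice st c
    × (∀ i → pos st' i ≡ newPos st c i)
    × (∀ i → moves st' i ≡ newMoves st c i)
    × (∀ w → prot st' w ≡ (prot st w ∨ occupied (newPos st c) w))

  initial : (Fin s → Fin N) → GState N s
  initial p = record
    { pos   = p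
    ; moves = λ _ → 0
    ; prot  = occupied p
    }

  Successful : (Fin s → Fin N) → Set
  Successful p = ∃ λ st → Star Stage (initial p) st × (∀ w → prot st w ≡ true)

-- "d_k(A) ≥ b": every successful layout uses at least b searchers
dk≥ : ∀ {N} → (Fin N → Fin N → Bool) → ℕ → ℕ → Set
dk≥ {N} A k b = ∀ (s : ℕ) (p : Fin s → Fin N) → Game.Successful A k p → b ≤ s

-- Call the protected set spanning if it meets every column {x} × V(H) or every row V(G) × {y};
-- the final protected set spans. If the initial one already spans, look at the first stage in
-- which some vertex v fires (or at the end of the play): no searcher has moved yet, so every
-- protected vertex is occupied and every unprotected neighbour of v receives a searcher from v.
-- Otherwise look at the stage after which the protected set first spans, say by columns, and count
-- searchers after it: before it some column xₑ and some row were entirely unprotected, so a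
-- searcher entered xₑ from a firing vertex v in a column adjacent to xₑ, and by connectivity of H
-- every other column that held a protected vertex held one next to an unprotected vertex, which
-- is occupied and keeps a searcher in its column. Either way every column contains a searcher,
-- and the column of v together with an adjacent one contains 2 deg(py v) + 1 of them: each vertex
-- other than v in these two columns and in the rows N_H[py v] is served by its own searcher, which
-- sits on it or is sent to it from v. Hence s ≥ (m − 2) + 2δ(H) + 1, or symmetrically for rows.

module Submission where

open import Defs hiding (sym)
open import Data.Nat
  using (ℕ; zero; suc; _+_; _*_; _∸_; _⊓_; _≤_; _<_; z≤n; s≤s; s≤s⁻¹; _<?_; _≤?_)
open import Data.Nat.Properties
  using (+-suc; +-assoc; +-comm; +-identityʳ; +-monoʳ-≤; +-monoˡ-≤; *-monoʳ-≤;
         ≤-refl; ≤-reflexive; ≤-trans; m⊓n≤m; m⊓n≤n; <ᵇ⇒<; m≤n+o⇒m∸n≤o; module ≤-Reasoning)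
open import Data.Bool using (Bool; true; false; _∧_; _∨_; not; if_then_else_)
open import Data.Bool.Properties using (∨-zeroʳ; ∧-identityʳ; T-≡; ¬-not) renaming (_≟_ to _≟ᵇ_)
open import Function.Bundles using (Equivalence)
open import Data.Fin
  using (Fin; zero; suc; fromℕ<; _≟_; punchIn; combine; remQuot; _↑ˡ_; _↑ʳ_; splitAt; join)
open import Data.Fin.Properties
  using (any?; all?; ¬∀⟶∃¬; suc-injective; punchInᵢ≢i; remQuot-combine; combine-remQuot;
         splitAt-↑ˡ; splitAt-↑ʳ; join-splitAt)
open import Data.Product using (_×_; _,_; ∃; ∃₂; proj₁; proj₂)
open import Data.Sum using (_⊎_; inj₁; inj₂; [_,_])
open import Function using (_∘_; flip; case_of_)
import Data.Product as Product
open import Data.Empty using (⊥; ⊥-elim)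
open import Relation.Nullary using (¬_; Dec; yes; no; contradiction)
open import Data.Maybe using (Maybe; just; nothing)
open import Data.Maybe.Properties using (just-injective)
open import Relation.Nullary.Decidable using (dec-true; dec-false; _×-dec_; _⊎-dec_)
open import Relation.Binary.PropositionalEquality using (_≡_; _≢_; refl; sym; trans; cong; cong₂; subst)
open import Relation.Binary.Construct.Closure.ReflexiveTransitive using (Star; ε; _◅_)

eqB⇒≡ : ∀ {n} {x y : Fin n} → eqB x y ≡ true → x ≡ y
eqB⇒≡ {x = x} {y} e with x ≟ y
... | yes x≡y = x≡y
... | no _    = contradiction e λ ()

≡⇒eqB : ∀ {n} {x y : Fin n} → x ≡ y → eqB x y ≡ true
≡⇒eqB {x = x} {y} = dec-true (x ≟ y)

≢⇒eqB : ∀ {n} {x y : Fin n} → x ≢ y → eqB x y ≡ false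
≢⇒eqB {x = x} {y} = dec-false (x ≟ y)

∧≡true : ∀ {a b} → a ∧ b ≡ true → a ≡ true × b ≡ true
∧≡true {true} {true} _ = refl , refl

-- Counting

countF-cong : ∀ {n} {f g : Fin n → Bool} → (∀ i → f i ≡ g i) → countF f ≡ countF g
countF-cong {zero}  f≗g = refl
countF-cong {suc n} f≗g =
  cong₂ _+_ (cong (λ b → if b then 1 else 0) (f≗g zero)) (countF-cong (f≗g ∘ suc))

countF-false : ∀ n → countF {n} (λ _ → false) ≡ 0
countF-false zero    = refl
countF-false (suc n) = countF-false n

countF-eqB : ∀ {n} (j : Fin n) → countF (eqB j) ≡ 1
countF-eqB {suc n} zero    = cong suc (countF-false n)
countF-eqB         (suc j) = countF-eqB j

countF-∨ : ∀ {n} (f g : Fin n → Bool) → (∀ i → f i ≡ true → g i ≡ true → ⊥) →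
  countF (λ i → f i ∨ g i) ≡ countF f + countF g
countF-∨ {zero}  f g disjoint = refl
countF-∨ {suc n} f g disjoint with f zero in f₀ | g zero in g₀
... | true  | true  = ⊥-elim (disjoint zero f₀ g₀)
... | true  | false = cong suc (countF-∨ (f ∘ suc) (g ∘ suc) (disjoint ∘ suc))
... | false | true  =
  trans (cong suc (countF-∨ (f ∘ suc) (g ∘ suc) (disjoint ∘ suc)))
        (sym (+-suc (countF (f ∘ suc)) (countF (g ∘ suc))))
... | false | false = countF-∨ (f ∘ suc) (g ∘ suc) (disjoint ∘ suc)

countF-not : ∀ {n} (f : Fin n → Bool) → countF f + countF (λ i → not (f i)) ≡ n
countF-not {zero}  f = refl
countF-not {suc n} f with f zero
... | true  = cong suc (countF-not (f ∘ suc))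
... | false = trans (+-suc _ _) (cong suc (countF-not (f ∘ suc)))

countF-split : ∀ m {n} (f : Fin (m + n) → Bool) →
  countF f ≡ countF (λ i → f (i ↑ˡ n)) + countF (λ j → f (m ↑ʳ j))
countF-split zero    f = refl
countF-split (suc m) {n} f =
  trans (cong ((if f zero then 1 else 0) +_) (countF-split m (f ∘ suc)))
        (sym (+-assoc (if f zero then 1 else 0) (countF (λ i → f (suc (i ↑ˡ n)))) _))

countF-remove : ∀ {n} {f : Fin n → Bool} (j : Fin n) → f j ≡ true →
  countF f ≡ suc (countF (λ i → f i ∧ not (eqB j i)))
countF-remove {suc n} {f} zero fj rewrite fj =
  cong suc (countF-cong (λ i → sym (∧-identityʳ (f (suc i)))))
countF-remove {suc n} {f} (suc j) fj with f zero
... | true  = cong suc (countF-remove {f = f ∘ suc} j fj)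
... | false = countF-remove {f = f ∘ suc} j fj

countF-pos : ∀ {n} {f : Fin n → Bool} (i : Fin n) → f i ≡ true → 0 < countF f
countF-pos i fi = ≤-trans (s≤s z≤n) (≤-reflexive (sym (countF-remove i fi)))

countF-witness : ∀ {n} {f : Fin n → Bool} → 0 < countF f → ∃ λ i → f i ≡ true
countF-witness {suc n} {f} pos with f zero in f₀
... | true  = zero , f₀
... | false = let i , fi = countF-witness {f = f ∘ suc} pos in suc i , fi

countF-≤-inj : ∀ {k s} {P : Fin k → Bool} {Q : Fin s → Bool} (R : Fin k → Fin s → Set) →
  (∀ i → P i ≡ true → ∃ λ j → Q j ≡ true × R i j) →
  (∀ {i i' j} → P i ≡ true → P i' ≡ true → R i j → R i' j → i ≡ i') →
  countF P ≤ countF Q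
countF-≤-inj {zero}  R hit inj = z≤n
countF-≤-inj {suc k} {P = P} {Q} R hit inj with P zero in P₀
... | false = countF-≤-inj (R ∘ suc) (hit ∘ suc) (λ p p' r r' → suc-injective (inj p p' r r'))
... | true with hit zero P₀
...   | j₀ , Qj₀ , Rj₀ = begin
  suc (countF (P ∘ suc)) ≤⟨ s≤s (countF-≤-inj (R ∘ suc) hit' inj') ⟩
  suc (countF Q∖j₀)      ≡⟨ countF-remove j₀ Qj₀ ⟨
  countF Q               ∎
  where
  open ≤-Reasoning
  Q∖j₀ : Fin _ → Bool
  Q∖j₀ j = Q j ∧ not (eqB j₀ j)
  inj' : ∀ {i i' j} → P (suc i) ≡ true → P (suc i') ≡ true → R (suc i) j → R (suc i') j → i ≡ i'
  inj' p p' r r' = suc-injective (inj p p' r r')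
  hit' : ∀ i → P (suc i) ≡ true → ∃ λ j → Q∖j₀ j ≡ true × R (suc i) j
  hit' i p with hit (suc i) p
  ... | j , Qj , Rij = j , cong₂ _∧_ Qj (cong not (≢⇒eqB j₀≢j)) , Rij
    where
    j₀≢j : j₀ ≢ j
    j₀≢j refl = contradiction (inj P₀ p Rj₀ Rij) λ ()

countF-⊎-≤-inj : ∀ {k l s} {P₁ : Fin k → Bool} {P₂ : Fin l → Bool} {Q : Fin s → Bool}
  (R : Fin k ⊎ Fin l → Fin s → Set) →
  (∀ i → [ P₁ , P₂ ] i ≡ true → ∃ λ j → Q j ≡ true × R i j) →
  (∀ {i i' j} → [ P₁ , P₂ ] i ≡ true → [ P₁ , P₂ ] i' ≡ true → R i j → R i' j → i ≡ i') →
  countF P₁ + countF P₂ ≤ countF Q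
countF-⊎-≤-inj {k} {l} {P₁ = P₁} {P₂} {Q} R hit inj = begin
  countF P₁ + countF P₂          ≡⟨ cong₂ _+_ (countF-cong on-left) (countF-cong on-right) ⟨
  countF (P ∘ (_↑ˡ l)) + countF (P ∘ (k ↑ʳ_)) ≡⟨ countF-split k P ⟨
  countF P                       ≤⟨ countF-≤-inj (R ∘ splitAt k) (hit ∘ splitAt k) inj' ⟩
  countF Q                       ∎
  where
  open ≤-Reasoning
  P : Fin (k + l) → Bool
  P i = [ P₁ , P₂ ] (splitAt k i)
  on-left : ∀ i → P (i ↑ˡ l) ≡ P₁ i
  on-left i = cong [ P₁ , P₂ ] (splitAt-↑ˡ k i l)
  on-right : ∀ j → P (k ↑ʳ j) ≡ P₂ j
  on-right j = cong [ P₁ , P₂ ] (splitAt-↑ʳ k l j)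
  inj' : ∀ {i i' j} → P i ≡ true → P i' ≡ true → R (splitAt k i) j → R (splitAt k i') j → i ≡ i'
  inj' {i} {i'} p p' r r' =
    trans (sym (join-splitAt k l i)) (trans (cong (join k l) (inj p p' r r')) (join-splitAt k l i'))

oneOf : ∀ {m} → Fin m → Fin m → Fin m → Bool
oneOf a b x = eqB a x ∨ eqB b x

oneOf-intro : ∀ {m} {a b x : Fin m} → x ≡ a ⊎ x ≡ b → oneOf a b x ≡ true
oneOf-intro {a = a} {b} (inj₁ refl) = cong (_∨ eqB b a) (≡⇒eqB {x = a} refl)
oneOf-intro {a = a} {b} (inj₂ refl) = trans (cong (eqB a b ∨_) (≡⇒eqB {x = b} refl)) (∨-zeroʳ (eqB a b))

¬oneOf⇒≢ : ∀ {m} {a b x : Fin m} → not (oneOf a b x) ≡ true → x ≢ a × x ≢ b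
¬oneOf⇒≢ {a = a} {b} {x} ¬ab =
  (λ x≡a → absurd (oneOf-intro {a = a} {b} (inj₁ x≡a))) ,
  (λ x≡b → absurd (oneOf-intro {a = a} {b} (inj₂ x≡b)))
  where
  absurd : oneOf a b x ≡ true → ⊥
  absurd ab = contradiction (trans (sym ¬ab) (cong not ab)) λ ()

countF-oneOf : ∀ {m} {a b : Fin m} → a ≢ b → countF (oneOf a b) ≡ 2
countF-oneOf {a = a} {b} a≢b =
  trans (countF-∨ (eqB a) (eqB b) disjoint) (cong₂ _+_ (countF-eqB a) (countF-eqB b))
  where
  disjoint : ∀ x → eqB a x ≡ true → eqB b x ≡ true → ⊥
  disjoint x ax bx = a≢b (trans (eqB⇒≡ ax) (sym (eqB⇒≡ bx)))

countF-oneOf-preimage : ∀ {m s} (f : Fin s → Fin m) {a b : Fin m} → a ≢ b →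
  (∀ x → x ≢ a → x ≢ b → ∃ λ j → f j ≡ x) →
  m + countF (λ j → oneOf a b (f j)) ≤ 2 + s
countF-oneOf-preimage {m} {s} f {a} {b} a≢b onto = begin
  m + countF (S ∘ f)                             ≡⟨ cong (_+ countF (S ∘ f)) (countF-not S) ⟨
  countF S + countF (not ∘ S) + countF (S ∘ f)
    ≡⟨ cong (λ c → c + countF (not ∘ S) + countF (S ∘ f)) (countF-oneOf a≢b) ⟩
  2 + countF (not ∘ S) + countF (S ∘ f)          ≤⟨ +-monoˡ-≤ (countF (S ∘ f)) (+-monoʳ-≤ 2 outside) ⟩
  2 + countF (not ∘ S ∘ f) + countF (S ∘ f)      ≡⟨ +-assoc 2 (countF (not ∘ S ∘ f)) (countF (S ∘ f)) ⟩
  2 + (countF (not ∘ S ∘ f) + countF (S ∘ f))    ≡⟨ cong (2 +_) (+-comm (countF (not ∘ S ∘ f)) _) ⟩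
  2 + (countF (S ∘ f) + countF (not ∘ S ∘ f))    ≡⟨ cong (2 +_) (countF-not (S ∘ f)) ⟩
  2 + s                                          ∎
  where
  open ≤-Reasoning
  S : Fin m → Bool
  S = oneOf a b
  outside : countF (not ∘ S) ≤ countF (not ∘ S ∘ f)
  outside = countF-≤-inj (λ x j → f j ≡ x) hit (λ _ _ fj≡x fj≡x' → trans (sym fj≡x) fj≡x')
    where
    hit : ∀ x → not (S x) ≡ true → ∃ λ j → not (S (f j)) ≡ true × f j ≡ x
    hit x ¬ab with ¬oneOf⇒≢ {a = a} {b} ¬ab
    ... | x≢a , x≢b with onto x x≢a x≢b
    ...   | j , fj≡x = j , subst (λ z → not (S z) ≡ true) (sym fj≡x) ¬ab , fj≡x

-- Graphs

adj⇒≢ : ∀ {n} (H : Graph n) {y u : Fin n} → Adj H y u → y ≢ u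
adj⇒≢ H {y} a refl = contradiction (trans (sym a) (irrefl H y)) λ ()

closedAdj-refl : ∀ {n} (H : Graph n) (y : Fin n) → closedAdj H y y ≡ true
closedAdj-refl H y = cong (_∨ adj H y y) (≡⇒eqB {x = y} refl)

adj⇒closedAdj : ∀ {n} (H : Graph n) {y u : Fin n} → Adj H y u → closedAdj H y u ≡ true
adj⇒closedAdj H {y} {u} a = trans (cong (eqB y u ∨_) a) (∨-zeroʳ (eqB y u))

closedAdj⇒≡⊎Adj : ∀ {n} (H : Graph n) {y u : Fin n} → closedAdj H y u ≡ true → y ≡ u ⊎ Adj H y u
closedAdj⇒≡⊎Adj H {y} {u} c with eqB y u in y≡u
... | true  = inj₁ (eqB⇒≡ y≡u)
... | false = inj₂ c

countF-closedAdj : ∀ {n} (H : Graph n) (y : Fin n) → countF (closedAdj H y) ≡ suc (deg H y)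
countF-closedAdj H y =
  trans (countF-∨ (eqB y) (adj H y) (λ u y≡u a → adj⇒≢ H a (eqB⇒≡ y≡u)))
        (cong (_+ deg H y) (countF-eqB y))

minF≤ : ∀ {n} (f : Fin (suc n) → ℕ) (i : Fin (suc n)) → minF f ≤ f i
minF≤ {zero}  f zero    = ≤-refl
minF≤ {suc n} f zero    = m⊓n≤m (f zero) _
minF≤ {suc n} f (suc i) = ≤-trans (m⊓n≤n (f zero) _) (minF≤ (f ∘ suc) i)

δ≤deg : ∀ {n} (H : Graph n) (y : Fin n) → δ H ≤ deg H y
δ≤deg {suc n} H y = minF≤ (deg H) y

connected⇒crossing-edge : ∀ {n} (H : Graph n) → Connected H → (T : Fin n → Bool) {a b : Fin n} →
  T a ≡ true → T b ≡ false → ∃₂ λ y y' → T y ≡ true × T y' ≡ false × Adj H y y'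
connected⇒crossing-edge H conn T {a} {b} Ta Tb = walk (conn a b) Ta
  where
  walk : ∀ {y} → Star (Adj H) y b → T y ≡ true → ∃₂ λ y y' → T y ≡ true × T y' ≡ false × Adj H y y'
  walk ε Tb' = contradiction (trans (sym Tb') Tb) λ ()
  walk {y} (_◅_ {j = y'} a rest) Ty with T y' in Ty'
  ... | true  = walk rest Ty'
  ... | false = y , y' , Ty , Ty' , a

connected⇒neighbour : ∀ {n} (H : Graph n) → Connected H → 2 ≤ n → (y : Fin n) → ∃ λ y' → Adj H y y'
connected⇒neighbour {suc zero}    H conn (s≤s ()) y
connected⇒neighbour {suc (suc n)} H conn _ y
  with connected⇒crossing-edge H conn (eqB y) {b = punchIn y zero}
         (≡⇒eqB {x = y} refl) (≢⇒eqB (punchInᵢ≢i y zero ∘ sym))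
... | y₀ , y' , y≡y₀ , _ , a = y' , subst (λ z → Adj H z y') (sym (eqB⇒≡ y≡y₀)) a

-- The game

module GameFacts {N : ℕ} (A : Fin N → Fin N → Bool) (k : ℕ) {s : ℕ} where
  open Game A k {s}

  occupied-pos : ∀ (p : Fin s → Fin N) i → occupied p (p i) ≡ true
  occupied-pos p i =
    dec-true (0 <? countF (λ j → eqB (p j) (p i)))
             (countF-pos {f = λ j → eqB (p j) (p i)} i (≡⇒eqB {x = p i} refl))

  occupied⇒∃ : ∀ (p : Fin s → Fin N) {w} → occupied p w ≡ true → ∃ λ i → p i ≡ w
  occupied⇒∃ p {w} occ =
    let i , e = countF-witness (<ᵇ⇒< 0 _ (Equivalence.from T-≡ occ)) in i , eqB⇒≡ e

  fires? : ∀ st v → Dec (Fires st v)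
  fires? st v = (0 <? unprotNbrs st v) ×-dec (unprotNbrs st v ≤? mobileOn st v)

  SearchersProtected : GState N s → Set
  SearchersProtected st = ∀ i → prot st (pos st i) ≡ true

  FrontierOccupied : GState N s → Set
  FrontierOccupied st =
    ∀ {w u} → prot st w ≡ true → A w u ≡ true → prot st u ≡ false → ∃ λ i → pos st i ≡ w

  Invariant : GState N s → Set
  Invariant st = SearchersProtected st × FrontierOccupied st

  Pristine : GState N s → Set
  Pristine st = ∀ {w} → prot st w ≡ true → ∃ λ i → pos st i ≡ w

  initial-invariant : ∀ p → Invariant (initial p)
  initial-invariant p = occupied-pos p , λ pw _ _ → occupied⇒∃ p pw

  initial-pristine : ∀ p → Pristine (initial p)
  initial-pristine p = occupied⇒∃ p

  module Step {st st' : GState N s} (stage : Stage st st') where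

    choice : Fin s → Maybe (Fin N)
    choice = proj₁ stage

    legal : ∀ {i w} → choice i ≡ just w →
      Fires st (pos st i) × A (pos st i) w ≡ true × prot st w ≡ false
    legal {i} {w} ci = proj₂ (proj₁ (proj₁ (proj₂ stage)) i w ci)

    complete : ∀ {v} → Fires st v → ∀ {w} → A v w ≡ true → prot st w ≡ false →
      ∃ λ i → pos st i ≡ v × choice i ≡ just w
    complete fv a pw = proj₂ (proj₁ (proj₂ stage)) _ fv _ a pw

    newPos-moved : ∀ i {w} → choice i ≡ just w → newPos st choice i ≡ w
    newPos-moved i ci with choice i
    ... | just w = just-injective ci

    newPos-stayed : ∀ i → choice i ≡ nothing → newPos st choice i ≡ pos st i
    newPos-stayed i ci with choice i
    ... | nothing = refl

    pos-after : ∀ i → pos st' i ≡ newPos st choice i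
    pos-after = proj₁ (proj₂ (proj₂ stage))

    prot-after : ∀ w → prot st' w ≡ (prot st w ∨ occupied (newPos st choice) w)
    prot-after = proj₂ (proj₂ (proj₂ (proj₂ stage)))

    stays : ∀ {i} → ¬ Fires st (pos st i) → choice i ≡ nothing
    stays {i} ¬fires with choice i in ci
    ... | nothing = refl
    ... | just w  = contradiction (proj₁ (legal ci)) ¬fires

    protected-after : ∀ {w} → prot st w ≡ true → prot st' w ≡ true
    protected-after {w} pw = trans (prot-after w) (cong (_∨ occupied (newPos st choice) w) pw)

    unprotected-before : ∀ {w} → prot st' w ≡ false → prot st w ≡ false
    unprotected-before {w} p'w with prot st w in pw
    ... | false = refl
    ... | true  = contradiction (trans (sym (protected-after pw)) p'w) λ ()

    occupied-after : ∀ i → prot st' (newPos st choice i) ≡ true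
    occupied-after i =
      trans (prot-after w) (trans (cong (prot st w ∨_) (occupied-pos (newPos st choice) i)) (∨-zeroʳ _))
      where w = newPos st choice i

    newly-occupied : ∀ {w} → prot st w ≡ false → prot st' w ≡ true → ∃ λ i → newPos st choice i ≡ w
    newly-occupied {w} pw p'w =
      occupied⇒∃ (newPos st choice)
        (trans (cong (_∨ occupied (newPos st choice) w) (sym pw)) (trans (sym (prot-after w)) p'w))

    newly-entered : SearchersProtected st → ∀ {w} → prot st w ≡ false → prot st' w ≡ true →
      ∃ λ i → choice i ≡ just w
    newly-entered prot-pos pw p'w with newly-occupied pw p'w
    ... | i , e with choice i in ci
    ...   | just u  = i , trans ci (cong just e)
    ...   | nothing = contradiction (trans (sym (prot-pos i)) (trans (cong (prot st) e) pw)) λ ()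

    idle-pristine : Pristine st → (∀ v → ¬ Fires st v) → Pristine st'
    idle-pristine pristine idle {w} p'w with prot st w in pw
    ... | true  = let i , at = pristine pw in
                  i , trans (pos-after i) (trans (newPos-stayed i (stays (idle (pos st i)))) at)
    ... | false = let i , e = newly-occupied pw p'w in i , trans (pos-after i) e

    frontier-kept : FrontierOccupied st → ∀ {w u} → prot st w ≡ true → A w u ≡ true → prot st u ≡ false →
      ∃ λ j → pos st j ≡ w × (choice j ≡ nothing ⊎ choice j ≡ just u)
    frontier-kept frontier {w} pw a pu with fires? st w
    ... | yes fires = let j , at , moves = complete fires a pu in j , at , inj₂ moves
    ... | no ¬fires = let j , at = frontier pw a pu in
                      j , at , inj₁ (stays (λ f → ¬fires (subst (Fires st) at f)))

  stage-invariant : ∀ {st st'} → Stage st st' → Invariant st → Invariant st'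
  stage-invariant {st} {st'} stage (prot-pos , frontier) = prot-pos' , frontier'
    where
    open Step stage
    prot-pos' : SearchersProtected st'
    prot-pos' i = subst (λ w → prot st' w ≡ true) (sym (pos-after i)) (occupied-after i)
    frontier' : FrontierOccupied st'
    frontier' {w} {u} p'w a p'u with prot st w in pw
    ... | true with frontier-kept frontier pw a (unprotected-before p'u)
    ...   | j , at , inj₁ stay = j , trans (pos-after j) (trans (newPos-stayed j stay) at)
    ...   | j , at , inj₂ move =
      let u-protected = subst (λ v → prot st' v ≡ true) (newPos-moved j move) (occupied-after j)
      in contradiction (trans (sym u-protected) p'u) λ ()
    frontier' {w} {u} p'w a p'u | false = let i , e = newly-occupied pw p'w in i , trans (pos-after i) e


-- Strong products in coordinates

record StrongProductCoords {N m n : ℕ} (G : Graph m) (H : Graph n) (A : Fin N → Fin N → Bool) : Set where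
  field
    px        : Fin N → Fin m
    py        : Fin N → Fin n
    mk        : Fin m → Fin n → Fin N
    px-mk     : ∀ x y → px (mk x y) ≡ x
    py-mk     : ∀ x y → py (mk x y) ≡ y
    mk-px-py  : ∀ p → mk (px p) (py p) ≡ p
    adj-intro : ∀ {p q} → p ≢ q → closedAdj G (px p) (px q) ≡ true → closedAdj H (py p) (py q) ≡ true →
                A p q ≡ true
    adj-elim  : ∀ {p q} → A p q ≡ true →
                closedAdj G (px p) (px q) ≡ true × closedAdj H (py p) (py q) ≡ true

swapCoords : ∀ {N m n} {G : Graph m} {H : Graph n} {A : Fin N → Fin N → Bool} →
  StrongProductCoords G H A → StrongProductCoords H G A
swapCoords coords = record
  { px        = py
  ; py        = px
  ; mk        = flip mk
  ; px-mk     = flip py-mk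
  ; py-mk     = flip px-mk
  ; mk-px-py  = mk-px-py
  ; adj-intro = λ p≢q h g → adj-intro p≢q g h
  ; adj-elim  = Product.swap ∘ adj-elim
  }
  where open StrongProductCoords coords

strongAdj-coords : ∀ {m n} (G : Graph m) (H : Graph n) → StrongProductCoords G H (strongAdj G H)
strongAdj-coords {m} {n} G H = record
  { px        = px
  ; py        = py
  ; mk        = combine
  ; px-mk     = λ x y → cong proj₁ (remQuot-combine x y)
  ; py-mk     = λ x y → cong proj₂ (remQuot-combine x y)
  ; mk-px-py  = combine-remQuot {m} n
  ; adj-intro = intro
  ; adj-elim  = elim
  }
  where
  px : Fin (m * n) → Fin m
  px p = proj₁ (remQuot {m} n p)
  py : Fin (m * n) → Fin n
  py p = proj₂ (remQuot {m} n p)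
  unfold : ∀ p q → strongAdj G H p q ≡
    (not (eqB (px p) (px q) ∧ eqB (py p) (py q)) ∧ (closedAdj G (px p) (px q) ∧ closedAdj H (py p) (py q)))
  unfold p q with remQuot {m} n p | remQuot {m} n q
  ... | _ | _ = refl
  intro : ∀ {p q} → p ≢ q → closedAdj G (px p) (px q) ≡ true → closedAdj H (py p) (py q) ≡ true →
    strongAdj G H p q ≡ true
  intro {p} {q} p≢q cg ch = trans (unfold p q) (cong₂ (λ a b → not a ∧ b) distinct (cong₂ _∧_ cg ch))
    where
    same : eqB (px p) (px q) ∧ eqB (py p) (py q) ≡ true → p ≡ q
    same e = let ex , ey = ∧≡true {eqB (px p) (px q)} e in
      trans (sym (combine-remQuot {m} n p))
        (trans (cong₂ combine (eqB⇒≡ {x = px p} ex) (eqB⇒≡ {x = py p} ey)) (combine-remQuot {m} n q))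
    distinct : eqB (px p) (px q) ∧ eqB (py p) (py q) ≡ false
    distinct = ¬-not (p≢q ∘ same)
  elim : ∀ {p q} → strongAdj G H p q ≡ true →
    closedAdj G (px p) (px q) ≡ true × closedAdj H (py p) (py q) ≡ true
  elim {p} {q} a =
    let _ , closed = ∧≡true {not (eqB (px p) (px q) ∧ eqB (py p) (py q))} (trans (sym (unfold p q)) a)
    in ∧≡true {closedAdj G (px p) (px q)} closed

-- Lower bounds from counting searchers column by column

module ColumnBounds {N m n : ℕ} {G : Graph m} {H : Graph n} {A : Fin N → Fin N → Bool}
  (coords : StrongProductCoords G H A) (k : ℕ) {s : ℕ} where
  open StrongProductCoords coords
  open Game A k {s}
  open GameFacts A k {s}

  MeetsEveryColumn : (Fin N → Bool) → Set
  MeetsEveryColumn S = ∀ x → ∃ λ y → S (mk x y) ≡ true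

  meetsEveryColumn? : ∀ S → Dec (MeetsEveryColumn S)
  meetsEveryColumn? S = all? λ x → any? λ y → S (mk x y) ≟ᵇ true

  ¬meets⇒empty-column : ∀ S → ¬ MeetsEveryColumn S → ∃ λ x → ∀ y → S (mk x y) ≡ false
  ¬meets⇒empty-column S ¬meets =
    let x , ¬meets-x = ¬∀⟶∃¬ m _ (λ x → any? λ y → S (mk x y) ≟ᵇ true) ¬meets
    in x , λ y → ¬-not (λ p → ¬meets-x (y , p))

  mk-injective : ∀ {x y x' y'} → mk x y ≡ mk x' y' → x ≡ x' × y ≡ y'
  mk-injective {x} {y} {x'} {y'} e =
    trans (sym (px-mk x y)) (trans (cong px e) (px-mk x' y')) ,
    trans (sym (py-mk x y)) (trans (cong py e) (py-mk x' y'))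

  off-column : ∀ {p x y} → x ≢ px p → p ≢ mk x y
  off-column {x = x} {y} x≢ e = x≢ (sym (trans (cong px e) (px-mk x y)))

  off-row : ∀ {p x y} → y ≢ py p → p ≢ mk x y
  off-row {x = x} {y} y≢ e = y≢ (sym (trans (cong py e) (py-mk x y)))

  adj-to-mk : ∀ {p x y} → p ≢ mk x y → closedAdj G (px p) x ≡ true → closedAdj H (py p) y ≡ true →
    A p (mk x y) ≡ true
  adj-to-mk {p} {x} {y} p≢ cg ch =
    adj-intro p≢ (subst (λ x' → closedAdj G (px p) x' ≡ true) (sym (px-mk x y)) cg)
                 (subst (λ y' → closedAdj H (py p) y' ≡ true) (sym (py-mk x y)) ch)

  adj-mk : ∀ {x y x' y'} → mk x y ≢ mk x' y' → closedAdj G x x' ≡ true → closedAdj H y y' ≡ true →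
    A (mk x y) (mk x' y') ≡ true
  adj-mk {x} {y} ne cg ch =
    adj-to-mk ne (subst (λ x₀ → closedAdj G x₀ _ ≡ true) (sym (px-mk x y)) cg)
                 (subst (λ y₀ → closedAdj H y₀ _ ≡ true) (sym (py-mk x y)) ch)

  data Serves (ps : Fin s → Fin N) (c : Fin s → Maybe (Fin N)) (v z : Fin N) (j : Fin s) : Set where
    sits : ps j ≡ z → z ≢ v → Serves ps c v z j
    sent : ps j ≡ v → c j ≡ just z → Serves ps c v z j

  serves-unique : ∀ {ps c v z z' j} → Serves ps c v z j → Serves ps c v z' j → z ≡ z'
  serves-unique (sits at _)   (sits at' _)    = trans (sym at) at'
  serves-unique (sits at z≢v) (sent at' _)    = contradiction (trans (sym at) at') z≢v
  serves-unique (sent at _)   (sits at' z'≢v) = contradiction (trans (sym at') at) z'≢v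
  serves-unique (sent _ cz)   (sent _ cz')    = just-injective (trans (sym cz) cz')

  served-two-columns : ∀ {ps c v x'} {Q : Fin s → Bool} → x' ≢ px v →
    (∀ y → closedAdj H (py v) y ≡ true → ∃ λ j → Q j ≡ true × Serves ps c v (mk x' y) j) →
    (∀ y → Adj H (py v) y → ∃ λ j → Q j ≡ true × Serves ps c v (mk (px v) y) j) →
    suc (deg H (py v)) + deg H (py v) ≤ countF Q
  served-two-columns {ps} {c} {v} {x'} {Q} x'≢x served-x' served-x = begin
    suc (deg H (py v)) + deg H (py v)
      ≡⟨ cong (_+ deg H (py v)) (countF-closedAdj H (py v)) ⟨
    countF (closedAdj H (py v)) + countF (adj H (py v))
      ≤⟨ countF-⊎-≤-inj (λ t → Serves ps c v (token t)) served inj ⟩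
    countF Q
      ∎
    where
    open ≤-Reasoning
    token : Fin n ⊎ Fin n → Fin N
    token = [ mk x' , mk (px v) ]
    served : ∀ t → [ closedAdj H (py v) , adj H (py v) ] t ≡ true →
      ∃ λ j → Q j ≡ true × Serves ps c v (token t) j
    served (inj₁ y) = served-x' y
    served (inj₂ y) = served-x y
    token-injective : ∀ {t t'} → token t ≡ token t' → t ≡ t'
    token-injective {inj₁ _} {inj₁ _} e = cong inj₁ (proj₂ (mk-injective e))
    token-injective {inj₁ _} {inj₂ _} e = contradiction (proj₁ (mk-injective e)) x'≢x
    token-injective {inj₂ _} {inj₁ _} e = contradiction (sym (proj₁ (mk-injective e))) x'≢x
    token-injective {inj₂ _} {inj₂ _} e = cong inj₂ (proj₂ (mk-injective e))
    inj : ∀ {t t' j} → _ → _ → Serves ps c v (token t) j → Serves ps c v (token t') j → t ≡ t'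
    inj _ _ r r' = token-injective (serves-unique r r')

  two-columns-bound : (f : Fin s → Fin m) {a b : Fin m} → a ≢ b → (∀ x → ∃ λ j → f j ≡ x) →
    (y : Fin n) → suc (deg H y) + deg H y ≤ countF (λ j → oneOf a b (f j)) → m + 2 * δ H ≤ suc s
  two-columns-bound f {a} {b} a≢b onto y tokens = s≤s⁻¹ (begin
    suc (m + 2 * δ H)          ≤⟨ s≤s (+-monoʳ-≤ m (*-monoʳ-≤ 2 (δ≤deg H y))) ⟩
    suc (m + 2 * d)            ≡⟨ cong (λ e → suc (m + (d + e))) (+-identityʳ d) ⟩
    suc (m + (d + d))          ≡⟨ +-suc m (d + d) ⟨
    m + (suc d + d)            ≤⟨ +-monoʳ-≤ m tokens ⟩
    m + countF (oneOf a b ∘ f)  ≤⟨ countF-oneOf-preimage f a≢b (λ x _ _ → onto x) ⟩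
    2 + s                      ∎)
    where
    open ≤-Reasoning
    d = deg H y

  module Transition (connH : Connected H) {st st' : GState N s} (inv : Invariant st) (stage : Stage st st')
    {xₑ yₑ} (column-empty : ∀ y → prot st (mk xₑ y) ≡ false) (row-empty : ∀ x → prot st (mk x yₑ) ≡ false)
    (meets : MeetsEveryColumn (prot st')) where
    open Step stage

    column : Fin s → Fin m
    column j = px (newPos st choice j)

    column-moved : ∀ {j z} → choice j ≡ just z → column j ≡ px z
    column-moved {j} cj = cong px (newPos-moved j cj)

    column-stayed : ∀ {j} → choice j ≡ nothing → column j ≡ px (pos st j)
    column-stayed {j} cj = cong px (newPos-stayed j cj)

    kept-in-column : ∀ {x y y'} → prot st (mk x y) ≡ true → prot st (mk x y') ≡ false → Adj H y y' →
      ∃ λ j → column j ≡ x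
    kept-in-column {x} {y} {y'} p p' a
      with frontier-kept (proj₂ inv) p along-column p'
      where
      along-column : A (mk x y) (mk x y') ≡ true
      along-column = adj-mk (adj⇒≢ H a ∘ proj₂ ∘ mk-injective) (closedAdj-refl G x) (adj⇒closedAdj H a)
    ... | j , at , inj₁ stay = j , trans (column-stayed stay) (trans (cong px at) (px-mk x y))
    ... | j , at , inj₂ move = j , trans (column-moved move) (px-mk x y')

    searcher-in-column : ∀ x → ∃ λ j → column j ≡ x
    searcher-in-column x with any? (λ y → prot st (mk x y) ≟ᵇ true)
    ... | yes (y , p) =
      let y , y' , py , py' , a = connected⇒crossing-edge H connH (λ y → prot st (mk x y)) p (row-empty x)
      in kept-in-column py py' a
    ... | no none =
      let y , p' = meets x
          i , e  = newly-occupied (¬-not (λ p → none (y , p))) p'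
      in i , trans (cong px e) (px-mk x y)

    entering : ∃ λ i → choice i ≡ just (mk xₑ (proj₁ (meets xₑ)))
    entering = newly-entered (proj₁ inv) (column-empty _) (proj₂ (meets xₑ))

    w₁ = pos st (proj₁ entering)
    x₁ = px w₁
    y₁ = py w₁

    w₁-fires : Fires st w₁
    w₁-fires = proj₁ (legal (proj₂ entering))

    xₑ≢x₁ : xₑ ≢ x₁
    xₑ≢x₁ xₑ≡x₁ = contradiction (trans (sym (proj₁ inv (proj₁ entering))) w₁-unprotected) λ ()
      where
      w₁-unprotected : prot st w₁ ≡ false
      w₁-unprotected =
        subst (λ x → prot st x ≡ false) (trans (cong (λ x → mk x y₁) xₑ≡x₁) (mk-px-py w₁)) (column-empty y₁)

    x₁~xₑ : Adj G x₁ xₑ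
    x₁~xₑ with closedAdj⇒≡⊎Adj G (subst (λ x → closedAdj G x₁ x ≡ true) (px-mk xₑ _) x₁≃)
      where x₁≃ = proj₁ (adj-elim (proj₁ (proj₂ (legal (proj₂ entering)))))
    ... | inj₁ x₁≡xₑ    = contradiction (sym x₁≡xₑ) xₑ≢x₁
    ... | inj₂ adjacent = adjacent

    in-columns : ∀ {j} → column j ≡ xₑ ⊎ column j ≡ x₁ → oneOf xₑ x₁ (column j) ≡ true
    in-columns = oneOf-intro

    sent-from-w₁ : ∀ {z} → A w₁ z ≡ true → prot st z ≡ false →
      ∃ λ j → column j ≡ px z × Serves (pos st) choice w₁ z j
    sent-from-w₁ a pz = let j , at , move = complete w₁-fires a pz in j , column-moved move , sent at move

    served-xₑ : ∀ y → closedAdj H y₁ y ≡ true →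
      ∃ λ j → oneOf xₑ x₁ (column j) ≡ true × Serves (pos st) choice w₁ (mk xₑ y) j
    served-xₑ y y₁≃y =
      let w₁~ = adj-to-mk (off-column xₑ≢x₁) (adj⇒closedAdj G x₁~xₑ) y₁≃y
          j , col , serves = sent-from-w₁ w₁~ (column-empty y)
      in j , in-columns (inj₁ (trans col (px-mk xₑ y))) , serves

    served-x₁ : ∀ y → Adj H y₁ y →
      ∃ λ j → oneOf xₑ x₁ (column j) ≡ true × Serves (pos st) choice w₁ (mk x₁ y) j
    served-x₁ y y₁~y with prot st (mk x₁ y) in p
    ... | false =
      let j , col , serves = sent-from-w₁ (adj-to-mk w₁≢ (closedAdj-refl G x₁) (adj⇒closedAdj H y₁~y)) p
      in j , in-columns (inj₂ (trans col (px-mk x₁ y))) , serves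
      where w₁≢ = off-row (adj⇒≢ H y₁~y ∘ sym)
    ... | true with frontier-kept (proj₂ inv) p towards-xₑ (column-empty y₁)
      where
      towards-xₑ : A (mk x₁ y) (mk xₑ y₁) ≡ true
      towards-xₑ = adj-mk (xₑ≢x₁ ∘ sym ∘ proj₁ ∘ mk-injective) (adj⇒closedAdj G x₁~xₑ)
                          (adj⇒closedAdj H (trans (Graph.sym H y y₁) y₁~y))
    ...   | j , at , inj₁ stay =
      j , in-columns (inj₂ (trans (column-stayed stay) (trans (cong px at) (px-mk x₁ y)))) , sits at ≢w₁
      where ≢w₁ = off-row (adj⇒≢ H y₁~y ∘ sym) ∘ sym
    ...   | j , at , inj₂ move =
      j , in-columns (inj₁ (trans (column-moved move) (px-mk xₑ y₁))) , sits at ≢w₁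
      where ≢w₁ = off-row (adj⇒≢ H y₁~y ∘ sym) ∘ sym

    bound : m + 2 * δ H ≤ suc s
    bound = two-columns-bound column xₑ≢x₁ searcher-in-column y₁
              (served-two-columns xₑ≢x₁ served-xₑ served-x₁)

  module FirstFiring (connG : Connected G) (2≤m : 2 ≤ m) {st : GState N s} (pristine : Pristine st)
    (meets : MeetsEveryColumn (prot st)) (v : Fin N) (c : Fin s → Maybe (Fin N))
    (sends : ∀ {u} → A v u ≡ true → prot st u ≡ false → ∃ λ j → pos st j ≡ v × c j ≡ just u) where

    column : Fin s → Fin m
    column j = px (pos st j)

    searcher-in-column : ∀ x → ∃ λ j → column j ≡ x
    searcher-in-column x = let y , p = meets x ; j , at = pristine p in j , trans (cong px at) (px-mk x y)

    x₁ = px v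
    x₂ = proj₁ (connected⇒neighbour G connG 2≤m x₁)

    x₁~x₂ : Adj G x₁ x₂
    x₁~x₂ = proj₂ (connected⇒neighbour G connG 2≤m x₁)

    x₂≢x₁ : x₂ ≢ x₁
    x₂≢x₁ = adj⇒≢ G x₁~x₂ ∘ sym

    in-columns : ∀ {j} → column j ≡ x₂ ⊎ column j ≡ x₁ → oneOf x₂ x₁ (column j) ≡ true
    in-columns = oneOf-intro

    served-near-v : ∀ {z} → v ≢ z → A v z ≡ true →
      ∃ λ j → (column j ≡ px z ⊎ column j ≡ x₁) × Serves (pos st) c v z j
    served-near-v {z} v≢z a with prot st z in p
    ... | true  = let j , at = pristine p in j , inj₁ (cong px at) , sits at (v≢z ∘ sym)
    ... | false = let j , at , cj = sends a p in j , inj₂ (cong px at) , sent at cj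

    served-x₂ : ∀ y → closedAdj H (py v) y ≡ true →
      ∃ λ j → oneOf x₂ x₁ (column j) ≡ true × Serves (pos st) c v (mk x₂ y) j
    served-x₂ y v≃y
      with served-near-v (off-column x₂≢x₁) (adj-to-mk (off-column x₂≢x₁) (adj⇒closedAdj G x₁~x₂) v≃y)
    ... | j , inj₁ col , serves = j , in-columns (inj₁ (trans col (px-mk x₂ y))) , serves
    ... | j , inj₂ col , serves = j , in-columns (inj₂ col) , serves

    served-x₁ : ∀ y → Adj H (py v) y →
      ∃ λ j → oneOf x₂ x₁ (column j) ≡ true × Serves (pos st) c v (mk x₁ y) j
    served-x₁ y v~y with served-near-v v≢ (adj-to-mk v≢ (closedAdj-refl G x₁) (adj⇒closedAdj H v~y))
      where v≢ = off-row (adj⇒≢ H v~y ∘ sym)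
    ... | j , inj₁ col , serves = j , in-columns (inj₂ (trans col (px-mk x₁ y))) , serves
    ... | j , inj₂ col , serves = j , in-columns (inj₂ col) , serves

    bound : m + 2 * δ H ≤ suc s
    bound = two-columns-bound column x₂≢x₁ searcher-in-column (py v)
              (served-two-columns x₂≢x₁ served-x₂ served-x₁)

-- Plays

first-crossing : ∀ {I : Set} {R : I → I → Set} {Inv P : I → Set} →
  (∀ {x y} → R x y → Inv x → Inv y) → (∀ x → Dec (P x)) →
  ∀ {x z} → Inv x → ¬ P x → Star R x z → P z →
  ∃₂ λ y y' → Inv y × R y y' × ¬ P y × P y'
first-crossing preserves P? inv ¬p ε                    p = contradiction p ¬p
first-crossing preserves P? inv ¬p (_◅_ {j = y'} r rs) p with P? y'
... | yes p' = _ , y' , inv , r , ¬p , p'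
... | no ¬p' = first-crossing preserves P? (preserves r inv) ¬p' rs p

module Spanning {N m n : ℕ} {G : Graph m} {H : Graph n} {A : Fin N → Fin N → Bool}
  (coords : StrongProductCoords G H A) (k : ℕ) {s : ℕ}
  (connG : Connected G) (connH : Connected H) (2≤m : 2 ≤ m) (2≤n : 2 ≤ n) where
  open StrongProductCoords coords
  open Game A k {s}
  open GameFacts A k {s}
  module Columns = ColumnBounds coords k {s}
  module Rows    = ColumnBounds (swapCoords coords) k {s}

  Spans : GState N s → Set
  Spans st = Columns.MeetsEveryColumn (prot st) ⊎ Rows.MeetsEveryColumn (prot st)

  spans? : ∀ st → Dec (Spans st)
  spans? st = Columns.meetsEveryColumn? (prot st) ⊎-dec Rows.meetsEveryColumn? (prot st)

  stage-spans : ∀ {st st'} → Stage st st' → Spans st → Spans st'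
  stage-spans stage (inj₁ meets) = inj₁ λ x → let y , p = meets x in y , Step.protected-after stage p
  stage-spans stage (inj₂ meets) = inj₂ λ y → let x , p = meets y in x , Step.protected-after stage p

  some-vertex : Fin N
  some-vertex = mk (fromℕ< (≤-trans (s≤s z≤n) 2≤m)) (fromℕ< (≤-trans (s≤s z≤n) 2≤n))

  full-spans : ∀ {st} → (∀ w → prot st w ≡ true) → Spans st
  full-spans full = inj₁ λ x → py some-vertex , full _

  Bound : Set
  Bound = m + 2 * δ H ≤ suc s ⊎ n + 2 * δ G ≤ suc s

  transition-case : ∀ {st st'} → Invariant st → Stage st st' → ¬ Spans st → Spans st' → Bound
  transition-case {st} inv stage ¬spans spans' =
    let xₑ , column-empty = Columns.¬meets⇒empty-column (prot st) (¬spans ∘ inj₁)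
        yₑ , row-empty    = Rows.¬meets⇒empty-column (prot st) (¬spans ∘ inj₂)
    in case spans' of λ where
      (inj₁ meets) → inj₁ (Columns.Transition.bound connH inv stage column-empty row-empty meets)
      (inj₂ meets) → inj₂ (Rows.Transition.bound connG inv stage row-empty column-empty meets)

  pristine-case : ∀ {st} → Pristine st → Spans st → ∀ v (c : Fin s → Maybe (Fin N)) →
    (∀ {u} → A v u ≡ true → prot st u ≡ false → ∃ λ j → pos st j ≡ v × c j ≡ just u) → Bound
  pristine-case {st} pristine (inj₁ meets) v c sends =
    inj₁ (Columns.FirstFiring.bound connG 2≤m {st} pristine meets v c sends)
  pristine-case {st} pristine (inj₂ meets) v c sends =
    inj₂ (Rows.FirstFiring.bound connH 2≤n {st} pristine meets v c sends)

  pristine-phase : ∀ {st stf} → Pristine st → Spans st → Star Stage st stf → (∀ w → prot stf w ≡ true) →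
    Bound
  pristine-phase {st} pristine spans ε full =
    pristine-case {st} pristine spans some-vertex (λ _ → nothing)
      λ _ pu → contradiction (trans (sym (full _)) pu) λ ()
  pristine-phase {st} pristine spans (stage ◅ rest) full with any? (fires? st)
  ... | yes (v , fires) = pristine-case {st} pristine spans v (Step.choice stage) (Step.complete stage fires)
  ... | no none =
    pristine-phase (Step.idle-pristine stage pristine (λ v f → none (v , f))) (stage-spans stage spans) rest full

  successful-bound : ∀ p → Successful p → Bound
  successful-bound p (stf , play , full) with spans? (initial p)
  ... | yes spans = pristine-phase (initial-pristine p) spans play full
  ... | no ¬spans =
    let _ , _ , inv , stage , ¬spans' , spans' =
          first-crossing {R = Stage} {Inv = Invariant} {P = Spans} stage-invariant spans?
            (initial-invariant p) ¬spans play (full-spans {stf} full)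
    in transition-case inv stage ¬spans' spans'

theorem5p1 : ∀ {m n : ℕ} (G : Graph m) (H : Graph n) →
    2 ≤ m → m ≤ n → Connected G → Connected H →
    ∀ (k : ℕ) → 1 ≤ k →
    dk≥ (strongAdj G H) k ((n + 2 * δ G ∸ 1) ⊓ (m + 2 * δ H ∸ 1))
theorem5p1 G H 2≤m m≤n connG connH k _ s p successful
  with Spanning.successful-bound (strongAdj-coords G H) k connG connH 2≤m (≤-trans 2≤m m≤n) p successful
... | inj₁ column-bound = ≤-trans (m⊓n≤n _ _) (m≤n+o⇒m∸n≤o _ 1 column-bound)
... | inj₂ row-bound    = ≤-trans (m⊓n≤m _ _) (m≤n+o⇒m∸n≤o _ 1 row-bound)
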